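{- Let $G$ be a cubic graph containing no $4$-cycle, and let $\overline{S}\subseteq V(G)$ be such that for all distinct $u,v\in\overline{S}$, $u\notin T_2(v)\cup T_4(v)$. Then $S=V(G)\setminus\overline{S}$ is a DET:OLD set of $G$.
   Context: For a graph $G$ and $v\in V(G)$, $N(v)$ is the open neighborhood of $v$. For $S\subseteq V(G)$ write $N_S(v)=N(v)\cap S$. A set $S\subseteq V(G)$ is a DET:OLD set of $G$ if (1) every vertex $v$ satisfies $|N_S(v)|\ge 2$, and (2) every pair of distinct vertices $u,v$ satisfies $|N_S(u)\setminus N_S(v)|\ge 2$ or $|N_S(v)\setminus N_S(u)|\ge 2$. A cubic graph is a 3-regular simple graph. A trail of length $k$ is a walk $v_0v_1\cdots v_k$ whose $k$ edges $v_{i-1}v_i$ are pairwise distinct; $T_k(v)$ denotes the set of vertices $w$ such that there is a trail of length $k$ from $v$ to $w$. -}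

module Defs where

open import Data.Nat using (ℕ; suc; _≥_)
open import Data.Bool using (Bool; true; false)
open import Data.Fin using (Fin; inject₁) renaming (suc to fsuc)
open import Data.Fin.Subset using (Subset; _∈_; _∉_; _∩_; _─_; ∣_∣; ⊤; ∁)
open import Data.Vec using (tabulate)
open import Data.Product using (_×_; Σ; ∃; ∃-syntax)
open import Data.Sum using (_⊎_)
open import Relation.Binary.PropositionalEquality using (_≡_; _≢_)
open import Relation.Nullary using (¬_)

record Graph (n : ℕ) : Set where
  field
    adj     : Fin n → Fin n → Bool
    symm    : ∀ u v → adj u v ≡ adj v u
    irrefl  : ∀ v → adj v v ≡ false

module _ {n : ℕ} (G : Graph n) where
  open Graph G

  Adj : Fin n → Fin n → Set
  Adj u v = adj u v ≡ true

  N : Fin n → Subset n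
  N v = tabulate (adj v)

  N[_] : Subset n → Fin n → Subset n
  N[ S ] v = N v ∩ S

  Cubic : Set
  Cubic = ∀ v → ∣ N v ∣ ≡ 3

  Has4Cycle : Set
  Has4Cycle = Σ (Fin n) λ a → Σ (Fin n) λ b → Σ (Fin n) λ c → Σ (Fin n) λ d →
    (a ≢ b × a ≢ c × a ≢ d × b ≢ c × b ≢ d × c ≢ d) ×
    (Adj a b × Adj b c × Adj c d × Adj d a)

  IsDETOLD : Subset n → Set
  IsDETOLD S =
    (∀ v → ∣ N[ S ] v ∣ ≥ 2) ×
    (∀ u v → u ≢ v →
       (∣ N[ S ] u ─ N[ S ] v ∣ ≥ 2) ⊎ (∣ N[ S ] v ─ N[ S ] u ∣ ≥ 2))

SameEdge : {n : ℕ} → Fin n → Fin n → Fin n → Fin n → Set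
SameEdge a b c d = (a ≡ c × b ≡ d) ⊎ (a ≡ d × b ≡ c)

module _ {n : ℕ} (G : Graph n) where
  open Graph G

  record Trail (k : ℕ) (u v : Fin n) : Set where
    field
      w       : Fin (suc k) → Fin n
      start   : w Data.Fin.zero ≡ u
      end     : w (Data.Fin.fromℕ k) ≡ v
      step    : ∀ (i : Fin k) → Adj G (w (inject₁ i)) (w (fsuc i))
      distinct : ∀ (i j : Fin k) → i ≢ j →
                 ¬ SameEdge (w (inject₁ i)) (w (fsuc i)) (w (inject₁ j)) (w (fsuc j))

  -- w ∈ T_k(v) iff there is a trail of length k from v to w
  InT : ℕ → Fin n → Fin n → Set
  InT k v u = Trail k v u

{-# OPTIONS --safe #-}

-- Every vertex has at most one neighbour in Sbar (two of them would be joined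
-- by a trail of length 2), and distinct vertices have at most one common
-- neighbour (G has no 4-cycle). So each vertex has two of its three neighbours
-- in S. For u ≢ v, a neighbour of u misses N_S(u) ─ N_S(v) only if it lies in
-- Sbar or is a common neighbour of u and v; hence u is separated from v unless
-- it has a neighbour i in Sbar and another neighbour c in common with v. If
-- this also happens for v, with k in Sbar, then both share the common neighbour
-- c and i-u-c-v-k is a trail of length 4 between distinct vertices of Sbar.
module Submission where

open import Defs
open import Level using (Level)
open import Data.Nat using (ℕ; suc; _≤_; _≥_; s≤s; z≤n)
open import Data.Nat.Properties using (≤-trans; ≤-reflexive)
open import Data.Fin using (Fin; zero; suc; inject₁; _≟_)
open import Data.Fin.Subset using (Subset; inside; outside; _∈_; _∉_; _─_; _-_; _∪_; ∁; ∣_∣)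
open import Data.Fin.Subset.Properties
  using (_∈?_; p─⊥≡p; p─q⊆p; x∈p⇒∣p-x∣<∣p∣; x∈p∧x≢y⇒x∈p-y; x∈p∧x∉q⇒x∈p─q;
         x∈p∩q⁺; x∈p∩q⁻; x∉p⇒x∈∁p; x∉⁅y⁆⇒x≢y; drop-there; p⊆p∪q; q⊆p∪q; x∈p∪q⁻)
open import Data.Vec using (_∷_; here; there)
open import Data.Vec.Properties using ([]=⇒lookup; lookup⇒[]=; lookup∘tabulate)
open import Data.Product using (_×_; _,_; ∃; proj₁; proj₂; ∃₂)
open import Data.Sum using (_⊎_; inj₁; inj₂)
open import Data.Empty using (⊥; ⊥-elim)
open import Function using (_∘_)
open import Relation.Binary.PropositionalEquality using (_≡_; _≢_; refl; sym; trans; subst)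
open import Relation.Nullary using (¬_; yes; no; contradiction)
open import Relation.Unary using (Pred; Decidable)

private
  variable
    ℓ : Level
    n k : ℕ
    p : Subset n

∣p∣≥1 : {x : Fin n} → x ∈ p → ∣ p ∣ ≥ 1
∣p∣≥1 x∈p = ≤-trans (s≤s z≤n) (x∈p⇒∣p-x∣<∣p∣ x∈p)

∣p∣≥2 : {x y : Fin n} → x ∈ p → y ∈ p → x ≢ y → ∣ p ∣ ≥ 2
∣p∣≥2 x∈p y∈p x≢y =
  ≤-trans (s≤s (∣p∣≥1 (x∈p∧x≢y⇒x∈p-y y∈p (x≢y ∘ sym)))) (x∈p⇒∣p-x∣<∣p∣ x∈p)

x∈p─q⇒x∉q : {x : Fin n} {q : Subset n} → x ∈ p ─ q → x ∉ q
x∈p─q⇒x∉q {p = _ ∷ _} {q = outside ∷ _} here      = λ ()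
x∈p─q⇒x∉q {p = _ ∷ _} {q = _ ∷ _}       (there h) = x∈p─q⇒x∉q h ∘ drop-there

x∈p-y⇒x≢y : {x y : Fin n} → x ∈ p - y → x ≢ y
x∈p-y⇒x≢y = x∉⁅y⁆⇒x≢y ∘ x∈p─q⇒x∉q

∃-∈-with-∣p-x∣ : (p : Subset n) → ∣ p ∣ ≥ suc k → ∃ λ x → x ∈ p × ∣ p - x ∣ ≥ k
∃-∈-with-∣p-x∣ {k = k} (inside ∷ p) (s≤s k≤∣p∣) =
  zero , here , subst (λ q → k ≤ ∣ q ∣) (sym (p─⊥≡p p)) k≤∣p∣
∃-∈-with-∣p-x∣ (outside ∷ p) h =
  let x , x∈p , k≤∣p-x∣ = ∃-∈-with-∣p-x∣ p h in suc x , there x∈p , k≤∣p-x∣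

∃-three-distinct : ∣ p ∣ ≥ 3 →
  ∃₂ λ x y → ∃ λ z → (x ∈ p × y ∈ p × z ∈ p) × (x ≢ y × x ≢ z × y ≢ z)
∃-three-distinct {p = p} ∣p∣≥3 =
  let x , x∈p     , ∣p-x∣≥2   = ∃-∈-with-∣p-x∣ p ∣p∣≥3
      y , y∈p-x   , ∣p-x-y∣≥1 = ∃-∈-with-∣p-x∣ (p - x) ∣p-x∣≥2
      z , z∈p-x-y , _         = ∃-∈-with-∣p-x∣ (p - x - y) ∣p-x-y∣≥1
      z∈p-x = p─q⊆p _ _ z∈p-x-y
  in  x , y , z , (x∈p , p─q⊆p _ _ y∈p-x , p─q⊆p _ _ z∈p-x) ,
      (x∈p-y⇒x≢y y∈p-x ∘ sym , x∈p-y⇒x≢y z∈p-x ∘ sym , x∈p-y⇒x≢y z∈p-x-y ∘ sym)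

TwoDistinct : (p : Subset n) → Pred (Fin n) ℓ → Set ℓ
TwoDistinct p P = ∃₂ λ x y → x ≢ y × (x ∈ p × P x) × (y ∈ p × P y)

two-of-three : {P : Pred (Fin n) ℓ} → Decidable P → ∣ p ∣ ≥ 3 →
  TwoDistinct p P ⊎ TwoDistinct p (¬_ ∘ P)
two-of-three P? ∣p∣≥3
  with x , y , z , (x∈p , y∈p , z∈p) , (x≢y , x≢z , y≢z) ← ∃-three-distinct ∣p∣≥3
  with P? x | P? y | P? z
... | yes Px | yes Py | _      = inj₁ (x , y , x≢y , (x∈p , Px) , (y∈p , Py))
... | no ¬Px | no ¬Py | _      = inj₂ (x , y , x≢y , (x∈p , ¬Px) , (y∈p , ¬Py))
... | yes Px | no ¬Py | yes Pz = inj₁ (x , z , x≢z , (x∈p , Px) , (z∈p , Pz))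
... | yes Px | no ¬Py | no ¬Pz = inj₂ (y , z , y≢z , (y∈p , ¬Py) , (z∈p , ¬Pz))
... | no ¬Px | yes Py | yes Pz = inj₁ (y , z , y≢z , (y∈p , Py) , (z∈p , Pz))
... | no ¬Px | yes Py | no ¬Pz = inj₂ (x , z , x≢z , (x∈p , ¬Px) , (z∈p , ¬Pz))

module GraphProperties (G : Graph n) where
  open Graph G

  infix 4 _~_
  _~_ : Fin n → Fin n → Set
  _~_ = Adj G

  private
    variable
      a b c d e u v x y : Fin n

  ~-sym : x ~ y → y ~ x
  ~-sym {x} {y} x~y = trans (symm y x) x~y

  ~⇒≢ : x ~ y → x ≢ y
  ~⇒≢ {x} x~x refl = contradiction (trans (sym x~x) (irrefl x)) λ ()

  ~⇒∈N : x ~ y → y ∈ N G x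
  ~⇒∈N {x} {y} x~y = lookup⇒[]= y _ (trans (lookup∘tabulate (adj x) y) x~y)

  ∈N⇒~ : y ∈ N G x → x ~ y
  ∈N⇒~ {y} {x} y∈N = trans (sym (lookup∘tabulate (adj x) y)) ([]=⇒lookup y∈N)

  ∈N[]⁺ : {S : Subset n} → v ~ x → x ∈ S → x ∈ N[ G ] S v
  ∈N[]⁺ v~x x∈S = x∈p∩q⁺ (~⇒∈N v~x , x∈S)

  common-neighbour-unique : ¬ Has4Cycle G → u ≢ v →
    u ~ c → v ~ c → u ~ d → v ~ d → c ≡ d
  common-neighbour-unique {u} {v} {c} {d} no4 u≢v u~c v~c u~d v~d with c ≟ d
  ... | yes c≡d = c≡d
  ... | no c≢d  = contradiction
    (u , c , v , d , (~⇒≢ u~c , u≢v , ~⇒≢ u~d , ~⇒≢ (~-sym v~c) , c≢d , ~⇒≢ v~d) ,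
                     (u~c , ~-sym v~c , v~d , ~-sym u~d))
    no4

  ¬SameEdge-sym : ¬ SameEdge a b c d → ¬ SameEdge c d a b
  ¬SameEdge-sym ¬ab=cd (inj₁ (c≡a , d≡b)) = ¬ab=cd (inj₁ (sym c≡a , sym d≡b))
  ¬SameEdge-sym ¬ab=cd (inj₂ (c≡b , d≡a)) = ¬ab=cd (inj₂ (sym d≡a , sym c≡b))

  ¬SameEdge-consecutive : a ~ b → a ≢ c → ¬ SameEdge a b b c
  ¬SameEdge-consecutive a~b _   (inj₁ (a≡b , _)) = ~⇒≢ a~b a≡b
  ¬SameEdge-consecutive _   a≢c (inj₂ (a≡c , _)) = a≢c a≡c

  ¬SameEdge-apart : b ~ c → a ≢ c → ¬ SameEdge a b c d
  ¬SameEdge-apart _   a≢c (inj₁ (a≡c , _)) = a≢c a≡c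
  ¬SameEdge-apart b~c _   (inj₂ (_ , b≡c)) = ~⇒≢ b~c b≡c

  trail₂ : a ~ b → b ~ c → a ≢ c → InT G 2 a c
  trail₂ {a} {b} {c} a~b b~c a≢c = record
    { w = w ; start = refl ; end = refl ; step = step ; distinct = distinct }
    where
    w : Fin 3 → Fin n
    w zero             = a
    w (suc zero)       = b
    w (suc (suc zero)) = c

    step : ∀ i → w (inject₁ i) ~ w (suc i)
    step zero       = a~b
    step (suc zero) = b~c

    ab≠bc : ¬ SameEdge a b b c
    ab≠bc = ¬SameEdge-consecutive a~b a≢c

    distinct : ∀ i j → i ≢ j →
      ¬ SameEdge (w (inject₁ i)) (w (suc i)) (w (inject₁ j)) (w (suc j))
    distinct zero       zero       i≢i = contradiction refl i≢i
    distinct zero       (suc zero) _   = ab≠bc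
    distinct (suc zero) zero       _   = ¬SameEdge-sym ab≠bc
    distinct (suc zero) (suc zero) i≢i = contradiction refl i≢i

  trail₄ : a ~ b → b ~ c → c ~ d → d ~ e →
    a ≢ c → b ≢ d → c ≢ e → ¬ (a ≡ d × b ≡ e) → InT G 4 a e
  trail₄ {a} {b} {c} {d} {e} a~b b~c c~d d~e a≢c b≢d c≢e ¬ab=de = record
    { w = w ; start = refl ; end = refl ; step = step ; distinct = distinct }
    where
    w : Fin 5 → Fin n
    w zero                         = a
    w (suc zero)                   = b
    w (suc (suc zero))             = c
    w (suc (suc (suc zero)))       = d
    w (suc (suc (suc (suc zero)))) = e

    step : ∀ i → w (inject₁ i) ~ w (suc i)
    step zero                   = a~b
    step (suc zero)             = b~c
    step (suc (suc zero))       = c~d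
    step (suc (suc (suc zero))) = d~e

    ab≠bc : ¬ SameEdge a b b c
    ab≠bc = ¬SameEdge-consecutive a~b a≢c
    bc≠cd : ¬ SameEdge b c c d
    bc≠cd = ¬SameEdge-consecutive b~c b≢d
    cd≠de : ¬ SameEdge c d d e
    cd≠de = ¬SameEdge-consecutive c~d c≢e
    ab≠cd : ¬ SameEdge a b c d
    ab≠cd = ¬SameEdge-apart b~c a≢c
    bc≠de : ¬ SameEdge b c d e
    bc≠de = ¬SameEdge-apart c~d b≢d
    ab≠de : ¬ SameEdge a b d e
    ab≠de (inj₁ ab=de)     = ¬ab=de ab=de
    ab≠de (inj₂ (_ , b≡d)) = b≢d b≡d

    distinct : ∀ i j → i ≢ j →
      ¬ SameEdge (w (inject₁ i)) (w (suc i)) (w (inject₁ j)) (w (suc j))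
    distinct zero                   (suc zero)             _ = ab≠bc
    distinct zero                   (suc (suc zero))       _ = ab≠cd
    distinct zero                   (suc (suc (suc zero))) _ = ab≠de
    distinct (suc zero)             (suc (suc zero))       _ = bc≠cd
    distinct (suc zero)             (suc (suc (suc zero))) _ = bc≠de
    distinct (suc (suc zero))       (suc (suc (suc zero))) _ = cd≠de
    distinct (suc zero)             zero                   _ = ¬SameEdge-sym ab≠bc
    distinct (suc (suc zero))       zero                   _ = ¬SameEdge-sym ab≠cd
    distinct (suc (suc (suc zero))) zero                   _ = ¬SameEdge-sym ab≠de
    distinct (suc (suc zero))       (suc zero)             _ = ¬SameEdge-sym bc≠cd
    distinct (suc (suc (suc zero))) (suc zero)             _ = ¬SameEdge-sym bc≠de
    distinct (suc (suc (suc zero))) (suc (suc zero))       _ = ¬SameEdge-sym cd≠de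
    distinct zero                   zero                   i≢i = contradiction refl i≢i
    distinct (suc zero)             (suc zero)             i≢i = contradiction refl i≢i
    distinct (suc (suc zero))       (suc (suc zero))       i≢i = contradiction refl i≢i
    distinct (suc (suc (suc zero))) (suc (suc (suc zero))) i≢i = contradiction refl i≢i

module DETOLD (G : Graph n) (cubic : Cubic G) (no4 : ¬ Has4Cycle G)
  (Sbar : Subset n)
  (far : ∀ u v → u ∈ Sbar → v ∈ Sbar → u ≢ v → (¬ InT G 2 v u) × (¬ InT G 4 v u))
  where
  open GraphProperties G

  private
    variable
      u v x y : Fin n

  S : Subset n
  S = ∁ Sbar

  ∣N∣≥3 : ∀ v → ∣ N G v ∣ ≥ 3
  ∣N∣≥3 v = ≤-reflexive (sym (cubic v))

  Sbar-neighbour-unique : v ~ x → v ~ y → x ∈ Sbar → y ∈ Sbar → x ≡ y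
  Sbar-neighbour-unique {x = x} {y = y} v~x v~y x∈Sbar y∈Sbar with x ≟ y
  ... | yes x≡y = x≡y
  ... | no  x≢y = contradiction (trail₂ (~-sym v~x) v~y x≢y)
                                (proj₁ (far y x y∈Sbar x∈Sbar (x≢y ∘ sym)))

  ∈N[S]⁺ : v ~ x → x ∉ Sbar → x ∈ N[ G ] S v
  ∈N[S]⁺ v~x x∉Sbar = ∈N[]⁺ v~x (x∉p⇒x∈∁p x∉Sbar)

  ∣N[S]∣≥2 : ∀ v → ∣ N[ G ] S v ∣ ≥ 2
  ∣N[S]∣≥2 v with two-of-three (_∈? Sbar) (∣N∣≥3 v)
  ... | inj₁ (x , y , x≢y , (x∈N , x∈Sbar) , (y∈N , y∈Sbar)) =
    contradiction (Sbar-neighbour-unique (∈N⇒~ x∈N) (∈N⇒~ y∈N) x∈Sbar y∈Sbar) x≢y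
  ... | inj₂ (x , y , x≢y , (x∈N , x∉Sbar) , (y∈N , y∉Sbar)) =
    ∣p∣≥2 (∈N[S]⁺ (∈N⇒~ x∈N) x∉Sbar) (∈N[S]⁺ (∈N⇒~ y∈N) y∉Sbar) x≢y

  record SbarAndCommonNeighbour (u v : Fin n) : Set where
    constructor sbar-and-common
    field
      {i c}  : Fin n
      i∈Sbar : i ∈ Sbar
      u~i    : u ~ i
      u~c    : u ~ c
      v~c    : v ~ c
      i≢c    : i ≢ c

  separated-or-obstructed : u ≢ v →
    ∣ N[ G ] S u ─ N[ G ] S v ∣ ≥ 2 ⊎ SbarAndCommonNeighbour u v
  separated-or-obstructed {u} {v} u≢v with two-of-three (_∈? Sbar ∪ N G v) (∣N∣≥3 u)
  ... | inj₂ (x , y , x≢y , (x∈N , x∉) , (y∈N , y∉)) =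
    inj₁ (∣p∣≥2 (separating x∈N x∉) (separating y∈N y∉) x≢y)
    where
    separating : {w : Fin n} → w ∈ N G u → w ∉ Sbar ∪ N G v → w ∈ N[ G ] S u ─ N[ G ] S v
    separating w∈N w∉ = x∈p∧x∉q⇒x∈p─q
      (∈N[S]⁺ (∈N⇒~ w∈N) (w∉ ∘ p⊆p∪q _))
      (w∉ ∘ q⊆p∪q Sbar _ ∘ proj₁ ∘ x∈p∩q⁻ _ _)
  ... | inj₁ (x , y , x≢y , (x∈N , x∈) , (y∈N , y∈)) =
    inj₂ (obstruction (x∈p∪q⁻ Sbar _ x∈) (x∈p∪q⁻ Sbar _ y∈))
    where
    obstruction : x ∈ Sbar ⊎ x ∈ N G v → y ∈ Sbar ⊎ y ∈ N G v → SbarAndCommonNeighbour u v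
    obstruction (inj₁ x∈Sbar) (inj₁ y∈Sbar) =
      contradiction (Sbar-neighbour-unique (∈N⇒~ x∈N) (∈N⇒~ y∈N) x∈Sbar y∈Sbar) x≢y
    obstruction (inj₁ x∈Sbar) (inj₂ y∈Nv) =
      sbar-and-common x∈Sbar (∈N⇒~ x∈N) (∈N⇒~ y∈N) (∈N⇒~ y∈Nv) x≢y
    obstruction (inj₂ x∈Nv) (inj₁ y∈Sbar) =
      sbar-and-common y∈Sbar (∈N⇒~ y∈N) (∈N⇒~ x∈N) (∈N⇒~ x∈Nv) (x≢y ∘ sym)
    obstruction (inj₂ x∈Nv) (inj₂ y∈Nv) =
      contradiction
        (common-neighbour-unique no4 u≢v (∈N⇒~ x∈N) (∈N⇒~ x∈Nv) (∈N⇒~ y∈N) (∈N⇒~ y∈Nv))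
        x≢y

  ¬mutually-obstructed : u ≢ v → SbarAndCommonNeighbour u v → SbarAndCommonNeighbour v u → ⊥
  ¬mutually-obstructed {u} {v} u≢v
    (sbar-and-common {i} {c} i∈Sbar u~i u~c v~c i≢c)
    (sbar-and-common {k}     k∈Sbar v~k v~c′ u~c′ k≢c′)
    with refl ← common-neighbour-unique no4 u≢v u~c v~c u~c′ v~c′
    = contradiction (trail₄ (~-sym u~i) u~c (~-sym v~c) v~k i≢c u≢v (k≢c′ ∘ sym) ¬iu=vk)
                    (proj₂ (far k i k∈Sbar i∈Sbar k≢i))
    where
    k≢i : k ≢ i
    k≢i refl = i≢c (common-neighbour-unique no4 u≢v u~i v~k u~c v~c)

    ¬iu=vk : ¬ (i ≡ v × u ≡ k)
    ¬iu=vk (refl , refl) = u≢v (Sbar-neighbour-unique (~-sym u~c) (~-sym v~c) k∈Sbar i∈Sbar)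

  isDETOLD : IsDETOLD G S
  isDETOLD = ∣N[S]∣≥2 , separated
    where
    separated : ∀ u v → u ≢ v →
      ∣ N[ G ] S u ─ N[ G ] S v ∣ ≥ 2 ⊎ ∣ N[ G ] S v ─ N[ G ] S u ∣ ≥ 2
    separated u v u≢v with separated-or-obstructed u≢v | separated-or-obstructed (u≢v ∘ sym)
    ... | inj₁ u-sep | _          = inj₁ u-sep
    ... | inj₂ _     | inj₁ v-sep = inj₂ v-sep
    ... | inj₂ ob    | inj₂ ob′   = ⊥-elim (¬mutually-obstructed u≢v ob ob′)

theorem10 : {n : ℕ} (G : Graph n) → Cubic G → ¬ Has4Cycle G →
    (Sbar : Subset n) →
    (∀ u v → u ∈ Sbar → v ∈ Sbar → u ≢ v → (¬ InT G 2 v u) × (¬ InT G 4 v u)) →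
    IsDETOLD G (∁ Sbar)
theorem10 G cubic no4 Sbar far = DETOLD.isDETOLD G cubic no4 Sbar far
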